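{- If $G$ is a connected bipartite graph that is Spartan, then $G$ admits a perfect matching.
   Context: All graphs are finite, simple and undirected. $mvc(G)$ denotes the size of a minimum vertex cover of $G$. Eternal vertex cover game: a defender first places guards on a subset of vertices; then in each round an attacker attacks an edge, and the defender must respond by moving guards, each guard moving at most one step along an edge (any number of guards may move simultaneously), such that at least one guard moves across the attacked edge; if this is impossible the attacker wins, and the defender wins if she can respond to every attack of an infinite sequence. $evc(G)$ is the minimum number of guards for which the defender has a winning strategy. $G$ is Spartan if $evc(G)=mvc(G)$. -}

module Defs where

open import Level using (0ℓ)
open import Data.Nat using (ℕ; _≤_)
open import Data.Fin using (Fin)
open import Data.Fin.Subset using (Subset; _∈_; ∣_∣)
open import Data.Bool using (Bool)
open import Data.Product using (Σ; _×_; _,_; ∃)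
open import Data.Sum using (_⊎_)
open import Relation.Nullary using (¬_; Dec)
open import Relation.Binary.PropositionalEquality using (_≡_; _≢_)
open import Relation.Binary.Construct.Closure.ReflexiveTransitive using (Star)
open import Function.Bundles using (_⇔_)
open import Data.List using (List; _∷_; [])
open import Data.List.Relation.Unary.All using (All)

record Graph : Set₁ where
  field
    n       : ℕ
    Adj     : Fin n → Fin n → Set
    adj?    : ∀ u v → Dec (Adj u v)
    sym     : ∀ {u v} → Adj u v → Adj v u
    irrefl  : ∀ {u} → ¬ Adj u u

module _ (G : Graph) where
  open Graph G

  Connected : Set
  Connected = ∀ (u v : Fin n) → Star Adj u v

  Bipartite : Set
  Bipartite = Σ (Fin n → Bool) λ c → ∀ u v → Adj u v → c u ≢ c v

  -- perfect matching: set of edges covering every vertex exactly once,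
  -- represented by the partner map m (a fixed-point-free involution along edges)
  PerfectMatching : Set
  PerfectMatching = Σ (Fin n → Fin n) λ m → ∀ v → Adj v (m v) × m (m v) ≡ v

  VertexCover : Subset n → Set
  VertexCover S = ∀ u v → Adj u v → u ∈ S ⊎ v ∈ S

  IsMVC : ℕ → Set
  IsMVC k = Σ (Subset n) (λ S → VertexCover S × ∣ S ∣ ≡ k)
          × (∀ S → VertexCover S → k ≤ ∣ S ∣)

  -- Configuration C (guard set, at most one guard per vertex) responds to an
  -- attack on edge uv by moving to C': each guard at w moves to f w, which is w or a
  -- neighbour of w; distinct guards go to distinct vertices; C' is the image of C;
  -- and some guard crosses the attacked edge.
  Move : Subset n → Fin n → Fin n → Subset n → Set
  Move C u v C' = Σ (Fin n → Fin n) λ f →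
      (∀ w → w ∈ C → f w ≡ w ⊎ Adj w (f w))
    × (∀ w w' → w ∈ C → w' ∈ C → f w ≡ f w' → w ≡ w')
    × (∀ x → (x ∈ C') ⇔ (∃ λ w → w ∈ C × f w ≡ x))
    × ((u ∈ C × f u ≡ v) ⊎ (v ∈ C × f v ≡ u))

  -- A history is the list of attacked edges so far, most recent first.
  Attack : Set
  Attack = Fin n × Fin n

  IsEdge : Attack → Set
  IsEdge (u , v) = Adj u v

  -- A defender strategy maps each finite (legal) attack history to the current guard
  -- configuration; it is winning with k guards if the initial placement has k guards
  -- and every attack on an edge after any legal history is answered by a legal move.
  -- This answers every attack of every infinite attack sequence.
  DefenderWins : ℕ → Set
  DefenderWins k = Σ (List Attack → Subset n) λ σ →
      ∣ σ [] ∣ ≡ k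
    × (∀ h → All IsEdge h → ∀ u v → Adj u v → Move (σ h) u v (σ ((u , v) ∷ h)))

  IsEVC : ℕ → Set
  IsEVC k = DefenderWins k × (∀ m → DefenderWins m → k ≤ m)

  Spartan : Set
  Spartan = Σ ℕ λ k → IsMVC k × IsEVC k

-- A configuration of a winning defender must answer every attack, so it is a vertex cover, and a move
-- never increases the number of guards; attacking an edge yx forces a guard onto x unless one is
-- already there. With evc(G) = mvc(G) guards, every vertex of a connected graph therefore lies in
-- a minimum vertex cover. In a bipartite graph with colour class A the minimum covers are closed
-- under C, D ↦ (A ∩ (C ∪ D)) ∪ (∁A ∩ C ∩ D), since the dual combination is a cover too and the two
-- sizes add up to |C| + |D|; so both colour classes are minimum covers. For a minimum cover A and
-- S ⊆ A, (A ─ S) ∪ N(S) is a cover, which is Hall's condition; Hall's theorem, proved by Rado's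
-- edge deletion, matches A into the other colour class, which has the same size.

module Submission where

open import Defs
open import Data.Nat using (ℕ; zero; suc; _+_; _≤_; _<_; z≤n; s≤s)
open import Data.Nat.Properties hiding (_≟_)
open import Data.Nat.Induction using (<-wellFounded)
open import Induction.WellFounded using (Acc; acc)
open import Data.Bool using (Bool; true; false; T; T?)
open import Data.Bool.Properties using (T-≡)
open import Data.Empty using (⊥; ⊥-elim)
open import Data.Product using (∃; _×_; _,_; proj₁; proj₂)
open import Data.Sum using (_⊎_; inj₁; inj₂; swap)
import Data.Sum as Sum
open import Data.Fin using (Fin; zero; suc; _≟_)
open import Data.Fin.Properties using (any?)
open import Data.Fin.Subset
  using (Subset; inside; outside; _∈_; _∉_; _⊆_; _∪_; _∩_; _─_; _-_; ∁; ⁅_⁆; ∣_∣; Nonempty; Empty)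
open import Data.Fin.Subset.Properties
  using (_∈?_; _⊆?_; nonempty?; anySubset?; Empty-unique; ∣⊥∣≡0; ∣⁅x⁆∣≡1; x∈⁅x⁆; x∈⁅y⁆⇒x≡y;
         x∉⁅y⁆⇒x≢y; x∈p∧x≢y⇒x∈p-y; x∈p⇒∣p-x∣<∣p∣; p─q⊆p; drop-∷-⊆; p⊆q⇒∣p∣≤∣q∣; p∩q⊆p; x∈p∪q⁺;
         x∈p∪q⁻; x∈p∩q⁺; x∈p∩q⁻; x∉p⇒x∈∁p; x∈∁p⇒x∉p; x∈p⇒x∉∁p; x∈p∧x∉q⇒x∈p─q)
open import Data.Vec using ([]; _∷_; here; there; tabulate; sum)
open import Data.Vec.Properties using (lookup∘tabulate; lookup⇒[]=; []=⇒lookup)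
open import Data.List using ([]; _∷_; allFin)
open import Data.List.Relation.Unary.All as All using (All; []; _∷_)
open import Data.List.Membership.Propositional.Properties using (∈-allFin)
open import Function using (_∘_; id)
open import Function.Bundles using (Equivalence)
open import Relation.Nullary using (¬_; Dec; yes; no; does; contradiction; ¬?)
open import Relation.Nullary.Decidable using (dec-true; _×-dec_; decidable-stable)
open import Relation.Unary using (Pred; Decidable)
open import Relation.Binary.PropositionalEquality
open import Relation.Binary.Construct.Closure.ReflexiveTransitive using (ε; _◅_)

private
  variable
    m n : ℕ
    p q S S₁ S₂ X : Subset n
    R : Fin n → Subset n
    x y y₁ y₂ z : Fin n

fromDec : ∀ {ℓ} {P : Pred (Fin n) ℓ} → Decidable P → Subset n
fromDec P? = tabulate (does ∘ P?)

module _ {ℓ} {P : Pred (Fin n) ℓ} (P? : Decidable P) where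

  ∈-fromDec⁺ : P x → x ∈ fromDec P?
  ∈-fromDec⁺ {x} px = lookup⇒[]= x _ (trans (lookup∘tabulate _ x) (dec-true (P? x) px))

  ∈-fromDec⁻ : x ∈ fromDec P? → P x
  ∈-fromDec⁻ {x} x∈ with P? x | trans (sym (lookup∘tabulate _ x)) ([]=⇒lookup x∈)
  ... | yes px | _ = px

x∈p─q⇒x∉q : x ∈ p ─ q → x ∉ q
x∈p─q⇒x∉q {p = _ ∷ _} {q = outside ∷ _} here        ()
x∈p─q⇒x∉q {p = _ ∷ _} {q = _ ∷ _}       (there x∈) (there x∈q) = x∈p─q⇒x∉q x∈ x∈q

x∈p-y⇒x≢y : x ∈ p - y → x ≢ y
x∈p-y⇒x≢y = x∉⁅y⁆⇒x≢y ∘ x∈p─q⇒x∉q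

x∈p⇒⁅x⁆⊆p : x ∈ p → ⁅ x ⁆ ⊆ p
x∈p⇒⁅x⁆⊆p {p = p} x∈p y∈⁅x⁆ = subst (_∈ p) (sym (x∈⁅y⁆⇒x≡y _ y∈⁅x⁆)) x∈p

Empty⇒∣p∣≡0 : ∀ {n} {p : Subset n} → Empty p → ∣ p ∣ ≡ 0
Empty⇒∣p∣≡0 {n} empty = trans (cong ∣_∣ (Empty-unique empty)) (∣⊥∣≡0 n)

0<∣p∣⇒Nonempty : 0 < ∣ p ∣ → Nonempty p
0<∣p∣⇒Nonempty {p = p} 0<∣p∣ with nonempty? p
... | yes nonempty = nonempty
... | no empty     = contradiction (Empty⇒∣p∣≡0 empty) (>⇒≢ 0<∣p∣)

∣∷∣+∣∷∣ : ∀ s t (p q p′ q′ : Subset n) → ∣ p ∣ + ∣ q ∣ ≡ ∣ p′ ∣ + ∣ q′ ∣ →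
          ∣ s ∷ p ∣ + ∣ t ∷ q ∣ ≡ ∣ s ∷ p′ ∣ + ∣ t ∷ q′ ∣
∣∷∣+∣∷∣ inside  inside  _ _ _ _ eq = cong suc (trans (+-suc _ _) (trans (cong suc eq) (sym (+-suc _ _))))
∣∷∣+∣∷∣ inside  outside _ _ _ _ eq = cong suc eq
∣∷∣+∣∷∣ outside inside  _ _ _ _ eq = trans (+-suc _ _) (trans (cong suc eq) (sym (+-suc _ _)))
∣∷∣+∣∷∣ outside outside _ _ _ _ eq = eq

∣p∪q∣+∣p∩q∣≡∣p∣+∣q∣ : ∀ (p q : Subset n) → ∣ p ∪ q ∣ + ∣ p ∩ q ∣ ≡ ∣ p ∣ + ∣ q ∣
∣p∪q∣+∣p∩q∣≡∣p∣+∣q∣ []            []            = refl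
∣p∪q∣+∣p∩q∣≡∣p∣+∣q∣ (inside  ∷ p) (t       ∷ q) =
  ∣∷∣+∣∷∣ inside t (p ∪ q) (p ∩ q) p q (∣p∪q∣+∣p∩q∣≡∣p∣+∣q∣ p q)
∣p∪q∣+∣p∩q∣≡∣p∣+∣q∣ (outside ∷ p) (inside  ∷ q) =
  trans (cong suc (∣p∪q∣+∣p∩q∣≡∣p∣+∣q∣ p q)) (sym (+-suc _ _))
∣p∪q∣+∣p∩q∣≡∣p∣+∣q∣ (outside ∷ p) (outside ∷ q) = ∣p∪q∣+∣p∩q∣≡∣p∣+∣q∣ p q

∣p∪q∣≤∣p∣+∣q∣ : ∀ (p q : Subset n) → ∣ p ∪ q ∣ ≤ ∣ p ∣ + ∣ q ∣
∣p∪q∣≤∣p∣+∣q∣ p q = ≤-trans (m≤m+n ∣ p ∪ q ∣ ∣ p ∩ q ∣) (≤-reflexive (∣p∪q∣+∣p∩q∣≡∣p∣+∣q∣ p q))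

q⊆p⇒∣p─q∣+∣q∣≡∣p∣ : q ⊆ p → ∣ p ─ q ∣ + ∣ q ∣ ≡ ∣ p ∣
q⊆p⇒∣p─q∣+∣q∣≡∣p∣ {q = []} {p = []}          _   = refl
q⊆p⇒∣p─q∣+∣q∣≡∣p∣ {q = inside  ∷ q} {p = inside  ∷ p} q⊆p =
  trans (+-suc _ _) (cong suc (q⊆p⇒∣p─q∣+∣q∣≡∣p∣ (drop-∷-⊆ q⊆p)))
q⊆p⇒∣p─q∣+∣q∣≡∣p∣ {q = outside ∷ q} {p = inside  ∷ p} q⊆p = cong suc (q⊆p⇒∣p─q∣+∣q∣≡∣p∣ (drop-∷-⊆ q⊆p))
q⊆p⇒∣p─q∣+∣q∣≡∣p∣ {q = outside ∷ q} {p = outside ∷ p} q⊆p = q⊆p⇒∣p─q∣+∣q∣≡∣p∣ (drop-∷-⊆ q⊆p)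
q⊆p⇒∣p─q∣+∣q∣≡∣p∣ {q = inside  ∷ q} {p = outside ∷ p} q⊆p with () ← q⊆p here

x∈p⇒suc∣p-x∣≡∣p∣ : x ∈ p → suc ∣ p - x ∣ ≡ ∣ p ∣
x∈p⇒suc∣p-x∣≡∣p∣ {x = x} {p = p} x∈p = begin
  suc ∣ p - x ∣         ≡⟨ +-comm 1 _ ⟩
  ∣ p - x ∣ + 1         ≡⟨ cong (∣ p - x ∣ +_) (sym (∣⁅x⁆∣≡1 x)) ⟩
  ∣ p - x ∣ + ∣ ⁅ x ⁆ ∣ ≡⟨ q⊆p⇒∣p─q∣+∣q∣≡∣p∣ (x∈p⇒⁅x⁆⊆p x∈p) ⟩
  ∣ p ∣                 ∎
  where open ≡-Reasoning

∣p∣≤1⇒x≡y : ∣ p ∣ ≤ 1 → x ∈ p → y ∈ p → x ≡ y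
∣p∣≤1⇒x≡y {p = p} {x = x} {y} ∣p∣≤1 x∈p y∈p with x ≟ y
... | yes x≡y = x≡y
... | no  x≢y = ⊥-elim (<-irrefl refl (begin-strict
  1         ≤⟨ ≤-<-trans z≤n (x∈p⇒∣p-x∣<∣p∣ (x∈p∧x≢y⇒x∈p-y y∈p (x≢y ∘ sym))) ⟩
  ∣ p - x ∣ <⟨ x∈p⇒∣p-x∣<∣p∣ x∈p ⟩
  ∣ p ∣     ≤⟨ ∣p∣≤1 ⟩
  1         ∎))
  where open ≤-Reasoning

InjectiveOn : (Fin n → Fin m) → Subset n → Set
InjectiveOn f p = ∀ {x y} → x ∈ p → y ∈ p → f x ≡ f y → x ≡ y

injectiveOn⇒∣p∣≤∣q∣ : ∀ {p : Subset n} {q : Subset m} (f : Fin n → Fin m) →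
                      (∀ {x} → x ∈ p → f x ∈ q) → InjectiveOn f p → ∣ p ∣ ≤ ∣ q ∣
injectiveOn⇒∣p∣≤∣q∣ f into inj = go into inj (<-wellFounded _)
  where
  go : ∀ {p q} → (∀ {x} → x ∈ p → f x ∈ q) → InjectiveOn f p → Acc _<_ ∣ p ∣ → ∣ p ∣ ≤ ∣ q ∣
  go {p} {q} into inj (acc rec) with nonempty? p
  ... | no empty = ≤-trans (≤-reflexive (Empty⇒∣p∣≡0 empty)) z≤n
  ... | yes (x , x∈p) = begin
    ∣ p ∣             ≡⟨ x∈p⇒suc∣p-x∣≡∣p∣ x∈p ⟨
    suc ∣ p - x ∣     ≤⟨ s≤s (go into′ inj′ (rec (x∈p⇒∣p-x∣<∣p∣ x∈p))) ⟩
    suc ∣ q - f x ∣   ≡⟨ x∈p⇒suc∣p-x∣≡∣p∣ (into x∈p) ⟩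
    ∣ q ∣             ∎
    where
    open ≤-Reasoning
    into′ : ∀ {y} → y ∈ p - x → f y ∈ q - f x
    into′ y∈ = x∈p∧x≢y⇒x∈p-y (into (p─q⊆p _ _ y∈)) (x∈p-y⇒x≢y y∈ ∘ inj (p─q⊆p _ _ y∈) x∈p)
    inj′ : InjectiveOn f (p - x)
    inj′ y∈ z∈ = inj (p─q⊆p _ _ y∈) (p─q⊆p _ _ z∈)

⊆-image⇒∣q∣≤∣p∣ : (f : Fin n → Fin n) → (∀ {y} → y ∈ q → ∃ λ x → x ∈ p × f x ≡ y) → ∣ q ∣ ≤ ∣ p ∣
⊆-image⇒∣q∣≤∣p∣ {q = q} {p = p} f onto = injectiveOn⇒∣p∣≤∣q∣ preimage (proj₁ ∘ preimage-spec) inj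
  where
  preimage : Fin _ → Fin _
  preimage y with y ∈? q
  ... | yes y∈q = proj₁ (onto y∈q)
  ... | no  _   = y
  preimage-spec : y ∈ q → preimage y ∈ p × f (preimage y) ≡ y
  preimage-spec {y} y∈q with y ∈? q
  ... | yes y∈q′ = proj₂ (onto y∈q′)
  ... | no  y∉q  = contradiction y∈q y∉q
  inj : InjectiveOn preimage q
  inj y∈q y′∈q eq = trans (sym (proj₂ (preimage-spec y∈q))) (trans (cong f eq) (proj₂ (preimage-spec y′∈q)))

injectiveOn⇒onto : ∀ {p : Subset n} {q : Subset m} (f : Fin n → Fin m) →
                   (∀ {x} → x ∈ p → f x ∈ q) → InjectiveOn f p → ∣ q ∣ ≤ ∣ p ∣ →
                   ∀ {y} → y ∈ q → ∃ λ x → x ∈ p × f x ≡ y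
injectiveOn⇒onto {p = p} {q} f into inj ∣q∣≤∣p∣ {y} y∈q with any? (λ x → x ∈? p ×-dec f x ≟ y)
... | yes found = found
... | no  none  = ⊥-elim (<-irrefl refl (begin-strict
  ∣ p ∣     ≤⟨ injectiveOn⇒∣p∣≤∣q∣ f into′ inj ⟩
  ∣ q - y ∣ <⟨ x∈p⇒∣p-x∣<∣p∣ y∈q ⟩
  ∣ q ∣     ≤⟨ ∣q∣≤∣p∣ ⟩
  ∣ p ∣     ∎))
  where
  open ≤-Reasoning
  into′ : ∀ {x} → x ∈ p → f x ∈ q - y
  into′ {x} x∈p = x∈p∧x≢y⇒x∈p-y (into x∈p) (λ fx≡y → none (x , x∈p , fx≡y))

select : Subset n → Subset n → Subset n → Subset n
select []            []      []      = []
select (inside  ∷ a) (s ∷ p) (_ ∷ q) = s ∷ select a p q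
select (outside ∷ a) (_ ∷ p) (t ∷ q) = t ∷ select a p q

x∈a⇒x∈p⇒x∈select : ∀ {a p q : Subset n} → x ∈ a → x ∈ p → x ∈ select a p q
x∈a⇒x∈p⇒x∈select {a = inside  ∷ _} {_ ∷ _} {_ ∷ _} here       here       = here
x∈a⇒x∈p⇒x∈select {a = inside  ∷ _} {_ ∷ _} {_ ∷ _} (there x∈a) (there x∈p) = there (x∈a⇒x∈p⇒x∈select x∈a x∈p)
x∈a⇒x∈p⇒x∈select {a = outside ∷ _} {_ ∷ _} {_ ∷ _} (there x∈a) (there x∈p) = there (x∈a⇒x∈p⇒x∈select x∈a x∈p)

x∉a⇒x∈q⇒x∈select : ∀ {a p q : Subset n} → x ∉ a → x ∈ q → x ∈ select a p q
x∉a⇒x∈q⇒x∈select {a = inside  ∷ _} {_ ∷ _} {_ ∷ _} x∉a here        = contradiction here x∉a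
x∉a⇒x∈q⇒x∈select {a = outside ∷ _} {_ ∷ _} {_ ∷ _} x∉a here        = here
x∉a⇒x∈q⇒x∈select {a = inside  ∷ _} {_ ∷ _} {_ ∷ _} x∉a (there x∈q) = there (x∉a⇒x∈q⇒x∈select (x∉a ∘ there) x∈q)
x∉a⇒x∈q⇒x∈select {a = outside ∷ _} {_ ∷ _} {_ ∷ _} x∉a (there x∈q) = there (x∉a⇒x∈q⇒x∈select (x∉a ∘ there) x∈q)

∣select∣+∣select-∁∣≡∣p∣+∣q∣ : ∀ (a p q : Subset n) → ∣ select a p q ∣ + ∣ select (∁ a) p q ∣ ≡ ∣ p ∣ + ∣ q ∣
∣select∣+∣select-∁∣≡∣p∣+∣q∣ []            []      []      = refl
∣select∣+∣select-∁∣≡∣p∣+∣q∣ (inside  ∷ a) (s ∷ p) (t ∷ q) =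
  ∣∷∣+∣∷∣ s t (select a p q) (select (∁ a) p q) p q (∣select∣+∣select-∁∣≡∣p∣+∣q∣ a p q)
∣select∣+∣select-∁∣≡∣p∣+∣q∣ (outside ∷ a) (s ∷ p) (t ∷ q) =
  trans (+-comm ∣ t ∷ select a p q ∣ _)
        (∣∷∣+∣∷∣ s t (select (∁ a) p q) (select a p q) p q
                 (trans (+-comm ∣ select (∁ a) p q ∣ _) (∣select∣+∣select-∁∣≡∣p∣+∣q∣ a p q)))

∈N? : (R : Fin n → Subset n) (S : Subset n) → Decidable (λ y → ∃ λ x → x ∈ S × y ∈ R x)
∈N? R S y = any? (λ x → x ∈? S ×-dec y ∈? R x)

N : (Fin n → Subset n) → Subset n → Subset n
N R S = fromDec (∈N? R S)

∈N⁺ : x ∈ S → y ∈ R x → y ∈ N R S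
∈N⁺ {S = S} {R = R} x∈S y∈Rx = ∈-fromDec⁺ (∈N? R S) (_ , x∈S , y∈Rx)

∈N⁻ : y ∈ N R S → ∃ λ x → x ∈ S × y ∈ R x
∈N⁻ {R = R} {S = S} = ∈-fromDec⁻ (∈N? R S)

HallCondition : (Fin n → Subset n) → Subset n → Set
HallCondition R X = ∀ {S} → S ⊆ X → ∣ S ∣ ≤ ∣ N R S ∣

Deficient : (Fin n → Subset n) → Subset n → Subset n → Set
Deficient R X S = S ⊆ X × ∣ N R S ∣ < ∣ S ∣

deficient? : ∀ (R : Fin n → Subset n) X → Dec (∃ (Deficient R X))
deficient? R X = anySubset? (λ S → S ⊆? X ×-dec ∣ N R S ∣ <? ∣ S ∣)

¬deficient⇒hall : ¬ ∃ (Deficient R X) → HallCondition R X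
¬deficient⇒hall none {S} S⊆X = ≮⇒≥ (λ lt → none (S , S⊆X , lt))

Transversal : (Fin n → Subset n) → Subset n → (Fin n → Fin n) → Set
Transversal R X g = (∀ {x} → x ∈ X → g x ∈ R x) × InjectiveOn g X

_without_ : (Fin n → Subset n) → Fin n × Fin n → Fin n → Subset n
(R without (x , y)) z with z ≟ x
... | yes _ = R z - y
... | no  _ = R z

without-⊆ : ∀ (R : Fin n → Subset n) e z → (R without e) z ⊆ R z
without-⊆ R (x , _) z with z ≟ x
... | yes _ = p─q⊆p _ _
... | no  _ = id

∈-without⁺ : ∀ (R : Fin n → Subset n) x y′ z → y ∈ R z → (z ≡ x → y ≢ y′) → y ∈ (R without (x , y′)) z
∈-without⁺ R x y′ z y∈Rz ok with z ≟ x
... | yes z≡x = x∈p∧x≢y⇒x∈p-y y∈Rz (ok z≡x)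
... | no  _   = y∈Rz

without-at : ∀ (R : Fin n → Subset n) x y → (R without (x , y)) x ≡ R x - y
without-at R x y with x ≟ x
... | yes _  = refl
... | no x≢x = contradiction refl x≢x

sum-tabulate-≤ : ∀ (f g : Fin m → ℕ) → (∀ i → f i ≤ g i) → sum (tabulate f) ≤ sum (tabulate g)
sum-tabulate-≤ {zero}  f g f≤g = z≤n
sum-tabulate-≤ {suc m} f g f≤g = +-mono-≤ (f≤g zero) (sum-tabulate-≤ (f ∘ suc) (g ∘ suc) (f≤g ∘ suc))

sum-tabulate-< : ∀ (f g : Fin m → ℕ) → (∀ i → f i ≤ g i) → ∀ j → f j < g j →
                 sum (tabulate f) < sum (tabulate g)
sum-tabulate-< f g f≤g zero    fj<gj = +-mono-<-≤ fj<gj (sum-tabulate-≤ (f ∘ suc) (g ∘ suc) (f≤g ∘ suc))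
sum-tabulate-< f g f≤g (suc j) fj<gj =
  +-mono-≤-< (f≤g zero) (sum-tabulate-< (f ∘ suc) (g ∘ suc) (f≤g ∘ suc) j fj<gj)

edges : (Fin n → Subset n) → ℕ
edges R = sum (tabulate (∣_∣ ∘ R))

edges-without-< : y ∈ R x → edges (R without (x , y)) < edges R
edges-without-< {y = y} {R = R} {x = x} y∈Rx =
  sum-tabulate-< _ _ (λ z → p⊆q⇒∣p∣≤∣q∣ (without-⊆ R (x , y) z)) x
    (subst (λ S → ∣ S ∣ < ∣ R x ∣) (sym (without-at R x y)) (x∈p⇒∣p-x∣<∣p∣ y∈Rx))

deficient-without⇒x∈S : HallCondition R X → Deficient (R without (x , y)) X S → x ∈ S
deficient-without⇒x∈S {R = R} {x = x} {y = y} {S = S} hall (S⊆X , ∣N∣<∣S∣) with x ∈? S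
... | yes x∈S = x∈S
... | no  x∉S = contradiction (≤-trans (hall S⊆X) (p⊆q⇒∣p∣≤∣q∣ N⊆)) (<⇒≱ ∣N∣<∣S∣)
  where
  N⊆ : N R S ⊆ N (R without (x , y)) S
  N⊆ y′∈N with ∈N⁻ y′∈N
  ... | z , z∈S , y′∈Rz = ∈N⁺ z∈S (∈-without⁺ R x y z y′∈Rz (λ { refl → contradiction z∈S x∉S }))

N-∪-without : y₁ ≢ y₂ → x ∈ S₁ → x ∈ S₂ →
              N R (S₁ ∪ S₂) ⊆ N (R without (x , y₁)) S₁ ∪ N (R without (x , y₂)) S₂
N-∪-without {y₁ = y₁} {y₂ = y₂} {x = x} {R = R} y₁≢y₂ x∈S₁ x∈S₂ {y} y∈N with ∈N⁻ y∈N
... | z , z∈S , y∈Rz with z ≟ x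
...   | no z≢x =
  x∈p∪q⁺ (Sum.map (λ z∈S₁ → ∈N⁺ z∈S₁ untouched) (λ z∈S₂ → ∈N⁺ z∈S₂ untouched) (x∈p∪q⁻ _ _ z∈S))
  where
  untouched : ∀ {y′} → y ∈ (R without (x , y′)) z
  untouched = ∈-without⁺ R x _ z y∈Rz (λ z≡x → contradiction z≡x z≢x)
...   | yes refl with y ≟ y₁
...     | yes refl = x∈p∪q⁺ (inj₂ (∈N⁺ x∈S₂ (∈-without⁺ R x y₂ x y∈Rz (λ _ → y₁≢y₂))))
...     | no  y≢y₁ = x∈p∪q⁺ (inj₁ (∈N⁺ x∈S₁ (∈-without⁺ R x y₁ x y∈Rz (λ _ → y≢y₁))))

N-∩-without : N R (S₁ ∩ S₂ - x) ⊆ N (R without (x , y₁)) S₁ ∩ N (R without (x , y₂)) S₂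
N-∩-without {R = R} {S₁ = S₁} {S₂ = S₂} {x = x} y∈N with ∈N⁻ y∈N
... | z , z∈I , y∈Rz = x∈p∩q⁺ (∈N⁺ z∈S₁ untouched , ∈N⁺ z∈S₂ untouched)
  where
  z∈S₁×z∈S₂ : z ∈ S₁ × z ∈ S₂
  z∈S₁×z∈S₂ = x∈p∩q⁻ S₁ S₂ (p─q⊆p _ _ z∈I)
  z∈S₁ : z ∈ S₁
  z∈S₁ = proj₁ z∈S₁×z∈S₂
  z∈S₂ : z ∈ S₂
  z∈S₂ = proj₂ z∈S₁×z∈S₂
  untouched : ∀ {y′} → _ ∈ (R without (x , y′)) z
  untouched = ∈-without⁺ R x _ z y∈Rz (λ z≡x → contradiction z≡x (x∈p-y⇒x≢y z∈I))

-- Rado: both deficient sets contain x, and then S₁ ∪ S₂ and S₁ ∩ S₂ - x together have too few neighbours.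
deficient-both⇒⊥ : HallCondition R X → y₁ ≢ y₂ →
                   Deficient (R without (x , y₁)) X S₁ → Deficient (R without (x , y₂)) X S₂ → ⊥
deficient-both⇒⊥ {R = R} {X = X} {y₁ = y₁} {y₂ = y₂} {x = x} {S₁ = S₁} {S₂ = S₂}
                 hall y₁≢y₂ d₁@(S₁⊆X , ∣N₁∣<∣S₁∣) d₂@(S₂⊆X , ∣N₂∣<∣S₂∣) =
  <-irrefl refl (begin-strict
    suc (∣ U ∣ + ∣ I ∣)              ≤⟨ s≤s (+-mono-≤ (hall U⊆X) (hall I⊆X)) ⟩
    suc (∣ N R U ∣ + ∣ N R I ∣)      ≤⟨ s≤s (+-mono-≤ (p⊆q⇒∣p∣≤∣q∣ NU⊆) (p⊆q⇒∣p∣≤∣q∣ NI⊆)) ⟩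
    suc (∣ N₁ ∪ N₂ ∣ + ∣ N₁ ∩ N₂ ∣)  ≡⟨ cong suc (∣p∪q∣+∣p∩q∣≡∣p∣+∣q∣ N₁ N₂) ⟩
    suc (∣ N₁ ∣ + ∣ N₂ ∣)            <⟨ s≤s (+-monoʳ-< ∣ N₁ ∣ (n<1+n _)) ⟩
    suc ∣ N₁ ∣ + suc ∣ N₂ ∣          ≤⟨ +-mono-≤ ∣N₁∣<∣S₁∣ ∣N₂∣<∣S₂∣ ⟩
    ∣ S₁ ∣ + ∣ S₂ ∣                  ≡⟨ ∣p∪q∣+∣p∩q∣≡∣p∣+∣q∣ S₁ S₂ ⟨
    ∣ U ∣ + ∣ S₁ ∩ S₂ ∣              ≡⟨ cong (∣ U ∣ +_) (x∈p⇒suc∣p-x∣≡∣p∣ (x∈p∩q⁺ (x∈S₁ , x∈S₂))) ⟨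
    ∣ U ∣ + suc ∣ I ∣                ≡⟨ +-suc _ _ ⟩
    suc (∣ U ∣ + ∣ I ∣)              ∎)
  where
  open ≤-Reasoning
  U I N₁ N₂ : Subset _
  U = S₁ ∪ S₂
  I = S₁ ∩ S₂ - x
  N₁ = N (R without (x , y₁)) S₁
  N₂ = N (R without (x , y₂)) S₂
  x∈S₁ : x ∈ S₁
  x∈S₁ = deficient-without⇒x∈S hall d₁
  x∈S₂ : x ∈ S₂
  x∈S₂ = deficient-without⇒x∈S hall d₂
  NU⊆ : N R U ⊆ N₁ ∪ N₂
  NU⊆ = N-∪-without y₁≢y₂ x∈S₁ x∈S₂
  NI⊆ : N R I ⊆ N₁ ∩ N₂
  NI⊆ = N-∩-without {R = R} {S₁ = S₁} {S₂ = S₂} {x = x} {y₁ = y₁} {y₂ = y₂}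
  U⊆X : U ⊆ X
  U⊆X y∈U = Sum.[ S₁⊆X , S₂⊆X ] (x∈p∪q⁻ S₁ S₂ y∈U)
  I⊆X : I ⊆ X
  I⊆X = S₁⊆X ∘ p∩q⊆p S₁ S₂ ∘ p─q⊆p _ _

hall-without⊎ : HallCondition R X → y₁ ≢ y₂ →
                HallCondition (R without (x , y₁)) X ⊎ HallCondition (R without (x , y₂)) X
hall-without⊎ {R = R} {X = X} {y₁ = y₁} {y₂ = y₂} {x = x} hall y₁≢y₂
  with deficient? (R without (x , y₁)) X | deficient? (R without (x , y₂)) X
... | no ¬d₁        | _             = inj₁ (¬deficient⇒hall ¬d₁)
... | yes _         | no ¬d₂        = inj₂ (¬deficient⇒hall ¬d₂)
... | yes (_ , d₁)  | yes (_ , d₂)  = ⊥-elim (deficient-both⇒⊥ hall y₁≢y₂ d₁ d₂)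

hall-functional : HallCondition R X → (∀ {x y y′} → y ∈ R x → y′ ∈ R x → y ≡ y′) → ∃ (Transversal R X)
hall-functional {R = R} {X = X} hall functional = choose , choose∈R , choose-injective
  where
  choose : Fin _ → Fin _
  choose x with nonempty? (R x)
  ... | yes (y , _) = y
  ... | no  _       = x

  R-nonempty : x ∈ X → Nonempty (R x)
  R-nonempty {x} x∈X
    with 0<∣p∣⇒Nonempty (≤-trans (≤-reflexive (sym (∣⁅x⁆∣≡1 x))) (hall (x∈p⇒⁅x⁆⊆p x∈X)))
  ... | y , y∈N with ∈N⁻ y∈N
  ... | z , z∈⁅x⁆ , y∈Rz = y , subst (λ w → y ∈ R w) (x∈⁅y⁆⇒x≡y x z∈⁅x⁆) y∈Rz

  choose∈R : x ∈ X → choose x ∈ R x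
  choose∈R {x} x∈X with nonempty? (R x)
  ... | yes (_ , y∈Rx) = y∈Rx
  ... | no  empty      = contradiction (R-nonempty x∈X) empty

  choose-injective : InjectiveOn choose X
  choose-injective {x} {x′} x∈X x′∈X same =
    ∣p∣≤1⇒x≡y ∣⁅x,x′⁆∣≤1 (x∈p∪q⁺ (inj₁ (x∈⁅x⁆ x))) (x∈p∪q⁺ (inj₂ (x∈⁅x⁆ x′)))
    where
    ⁅x,x′⁆ : Subset _
    ⁅x,x′⁆ = ⁅ x ⁆ ∪ ⁅ x′ ⁆
    ⁅x,x′⁆⊆X : ⁅x,x′⁆ ⊆ X
    ⁅x,x′⁆⊆X z∈⁅x,x′⁆ = Sum.[ x∈p⇒⁅x⁆⊆p x∈X , x∈p⇒⁅x⁆⊆p x′∈X ] (x∈p∪q⁻ _ _ z∈⁅x,x′⁆)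
    chosen : ∀ {z} → z ∈ ⁅x,x′⁆ → z ∈ X × choose z ≡ choose x
    chosen z∈⁅x,x′⁆ with x∈p∪q⁻ _ _ z∈⁅x,x′⁆
    ... | inj₁ z∈⁅x⁆  rewrite x∈⁅y⁆⇒x≡y _ z∈⁅x⁆  = x∈X , refl
    ... | inj₂ z∈⁅x′⁆ rewrite x∈⁅y⁆⇒x≡y _ z∈⁅x′⁆ = x′∈X , sym same
    N⊆⁅choose-x⁆ : N R ⁅x,x′⁆ ⊆ ⁅ choose x ⁆
    N⊆⁅choose-x⁆ y∈N with ∈N⁻ y∈N
    ... | z , z∈⁅x,x′⁆ , y∈Rz with chosen z∈⁅x,x′⁆
    ...   | z∈X , choose-z≡choose-x =
      subst (_∈ ⁅ choose x ⁆) (sym (trans (functional y∈Rz (choose∈R z∈X)) choose-z≡choose-x)) (x∈⁅x⁆ _)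
    ∣⁅x,x′⁆∣≤1 : ∣ ⁅x,x′⁆ ∣ ≤ 1
    ∣⁅x,x′⁆∣≤1 = ≤-trans (hall ⁅x,x′⁆⊆X)
                         (≤-trans (p⊆q⇒∣p∣≤∣q∣ N⊆⁅choose-x⁆) (≤-reflexive (∣⁅x⁆∣≡1 (choose x))))

-- Rado's proof: while some row R x has two entries, one of them can be deleted keeping Hall's condition.
hall : HallCondition R X → ∃ (Transversal R X)
hall {R = R} {X = X} hall-R = go R hall-R (<-wellFounded (edges R))
  where
  weaken : ∀ {R} e → ∃ (Transversal (R without e) X) → ∃ (Transversal R X)
  weaken {R} e (g , g∈R′ , injective) = g , (λ x∈X → without-⊆ R e _ (g∈R′ x∈X)) , injective

  go : ∀ R → HallCondition R X → Acc _<_ (edges R) → ∃ (Transversal R X)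
  go R hall-R (acc smaller)
    with any? (λ x → any? (λ y → y ∈? R x ×-dec any? (λ y′ → y′ ∈? R x ×-dec ¬? (y ≟ y′))))
  ... | no functional = hall-functional hall-R λ {x} {y} {y′} y∈Rx y′∈Rx →
        decidable-stable (y ≟ y′) (λ y≢y′ → functional (x , y , y∈Rx , y′ , y′∈Rx , y≢y′))
  ... | yes (x , y₁ , y₁∈Rx , y₂ , y₂∈Rx , y₁≢y₂) with hall-without⊎ hall-R y₁≢y₂
  ...   | inj₁ hall₁ = weaken (x , y₁) (go _ hall₁ (smaller (edges-without-< y₁∈Rx)))
  ...   | inj₂ hall₂ = weaken (x , y₂) (go _ hall₂ (smaller (edges-without-< y₂∈Rx)))

≢⇒¬T⇒T : ∀ {a b} → a ≢ b → ¬ T a → T b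
≢⇒¬T⇒T {true}          _   ¬Ta = contradiction _ ¬Ta
≢⇒¬T⇒T {false} {true}  _   _   = _
≢⇒¬T⇒T {false} {false} a≢b _   = contradiction refl a≢b

2≤m⇒∃≢ : 2 ≤ m → (x : Fin m) → ∃ λ x′ → x ≢ x′
2≤m⇒∃≢ (s≤s (s≤s z≤n)) zero    = suc zero , λ ()
2≤m⇒∃≢ (s≤s (s≤s z≤n)) (suc _) = zero     , λ ()

module _ (G : Graph) where
  open Graph G using (Adj; adj?) renaming (n to V; sym to Adj-sym)

  private
    variable
      u v : Fin V
      A C C′ D : Subset V
      k : ℕ

  neighbours : Fin V → Subset V
  neighbours u = fromDec (adj? u)

  Independent : Subset V → Set
  Independent A = ∀ {u v} → Adj u v → u ∈ A → v ∉ A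

  ColourClass : Subset V → Set
  ColourClass A = VertexCover G A × Independent A

  covers-other-end : VertexCover G C → Adj u v → u ∉ C → v ∈ C
  covers-other-end {u = u} {v} cover u~v u∉C with cover u v u~v
  ... | inj₁ u∈C = contradiction u∈C u∉C
  ... | inj₂ v∈C = v∈C

  colouring⇒colourClass : (c : Fin V → Bool) → (∀ u v → Adj u v → c u ≢ c v) →
                          ColourClass (fromDec (T? ∘ c))
  colouring⇒colourClass c proper = cover , independent
    where
    cover : VertexCover G (fromDec (T? ∘ c))
    cover u v u~v with T? (c u)
    ... | yes cu  = inj₁ (∈-fromDec⁺ (T? ∘ c) cu)
    ... | no  ¬cu = inj₂ (∈-fromDec⁺ (T? ∘ c) (≢⇒¬T⇒T (proper u v u~v) ¬cu))
    independent : Independent (fromDec (T? ∘ c))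
    independent {u} {v} u~v u∈ v∈ = proper u v u~v
      (trans (Equivalence.to T-≡ (∈-fromDec⁻ (T? ∘ c) u∈))
             (sym (Equivalence.to T-≡ (∈-fromDec⁻ (T? ∘ c) v∈))))

  colourClass-∁ : ColourClass A → ColourClass (∁ A)
  colourClass-∁ {A} (cover , independent) = cover∁ , independent∁
    where
    cover∁ : VertexCover G (∁ A)
    cover∁ u v u~v with u ∈? A
    ... | yes u∈A = inj₂ (x∉p⇒x∈∁p (independent u~v u∈A))
    ... | no  u∉A = inj₁ (x∉p⇒x∈∁p u∉A)
    independent∁ : Independent (∁ A)
    independent∁ u~v u∈∁A = x∈p⇒x∉∁p (covers-other-end cover u~v (x∈∁p⇒x∉p u∈∁A))

  cover-via : VertexCover G A → (∀ {u v} → Adj u v → u ∈ A → u ∈ C ⊎ v ∈ C) → VertexCover G C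
  cover-via {A} coverA from-A u v u~v with u ∈? A
  ... | yes u∈A = from-A u~v u∈A
  ... | no  u∉A = swap (from-A (Adj-sym u~v) (covers-other-end coverA u~v u∉A))

  select-cover : ColourClass A → VertexCover G C → VertexCover G D →
                 VertexCover G (select A (C ∪ D) (C ∩ D))
  select-cover {A} {C} {D} (coverA , independentA) coverC coverD = cover-via coverA from-A
    where
    from-A : Adj u v → u ∈ A → u ∈ select A (C ∪ D) (C ∩ D) ⊎ v ∈ select A (C ∪ D) (C ∩ D)
    from-A {u} u~v u∈A with u ∈? C ∪ D
    ... | yes u∈C∪D = inj₁ (x∈a⇒x∈p⇒x∈select u∈A u∈C∪D)
    ... | no  u∉C∪D = inj₂ (x∉a⇒x∈q⇒x∈select (independentA u~v u∈A)
                             (x∈p∩q⁺ ( covers-other-end coverC u~v (u∉C∪D ∘ x∈p∪q⁺ ∘ inj₁)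
                                     , covers-other-end coverD u~v (u∉C∪D ∘ x∈p∪q⁺ ∘ inj₂))))

  move⇒u∈C⊎v∈C : Move G C u v C′ → u ∈ C ⊎ v ∈ C
  move⇒u∈C⊎v∈C (_ , _ , _ , _ , crossing) = Sum.map proj₁ proj₁ crossing

  move⇒∣C′∣≤∣C∣ : Move G C u v C′ → ∣ C′ ∣ ≤ ∣ C ∣
  move⇒∣C′∣≤∣C∣ (f , _ , _ , image , _) = ⊆-image⇒∣q∣≤∣p∣ f (λ {y} → Equivalence.to (image y))

  winning⇒VertexCover : (win : DefenderWins G k) → ∀ h → All (IsEdge G) h →
                        VertexCover G (proj₁ win h)
  winning⇒VertexCover (_ , _ , respond) h legal u v u~v = move⇒u∈C⊎v∈C (respond h legal u v u~v)

  winning⇒vertex∈smallCover : DefenderWins G k → Adj y x →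
                              ∃ λ D → x ∈ D × VertexCover G D × ∣ D ∣ ≤ k
  winning⇒vertex∈smallCover {y = y} {x = x} win@(σ , ∣σ[]∣≡k , respond) y~x
    with respond [] [] y x y~x
  ... | move@(_ , _ , _ , image , inj₁ (y∈σ[] , fy≡x)) =
        σ ((y , x) ∷ []) , Equivalence.from (image x) (y , y∈σ[] , fy≡x) ,
        winning⇒VertexCover win _ (y~x ∷ []) , ≤-trans (move⇒∣C′∣≤∣C∣ move) (≤-reflexive ∣σ[]∣≡k)
  ... | _ , _ , _ , _ , inj₂ (x∈σ[] , _) =
        σ [] , x∈σ[] , winning⇒VertexCover win [] [] , ≤-reflexive ∣σ[]∣≡k

  connected⇒neighbour : 2 ≤ V → Connected G → ∀ x → ∃ λ y → Adj y x
  connected⇒neighbour 2≤n connected x with 2≤m⇒∃≢ 2≤n x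
  ... | x′ , x≢x′ with connected x x′
  ...   | ε         = contradiction refl x≢x′
  ...   | x~y ◅ _   = _ , Adj-sym x~y

  transversal⇒perfectMatching : ∀ {g} → ColourClass A → Transversal neighbours A g → ∣ ∁ A ∣ ≤ ∣ A ∣ →
                                PerfectMatching G
  transversal⇒perfectMatching {A} {g} (_ , independent) (g∈neighbours , g-injective) ∣∁A∣≤∣A∣ =
    partner , matched
    where
    g-adjacent : x ∈ A → Adj x (g x)
    g-adjacent {x} x∈A = ∈-fromDec⁻ (adj? x) (g∈neighbours x∈A)
    onto : y ∈ ∁ A → ∃ λ x → x ∈ A × g x ≡ y
    onto = injectiveOn⇒onto g (λ x∈A → x∉p⇒x∈∁p (independent (g-adjacent x∈A) x∈A)) g-injective ∣∁A∣≤∣A∣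
    partner : Fin V → Fin V
    partner v with v ∈? A
    ... | yes _   = g v
    ... | no  v∉A = proj₁ (onto (x∉p⇒x∈∁p v∉A))
    partner-in : x ∈ A → partner x ≡ g x
    partner-in {x} x∈A with x ∈? A
    ... | yes _   = refl
    ... | no  x∉A = contradiction x∈A x∉A
    partner-out : y ∉ A → partner y ∈ A × g (partner y) ≡ y
    partner-out {y} y∉A with y ∈? A
    ... | yes y∈A  = contradiction y∈A y∉A
    ... | no  y∉A′ = proj₂ (onto (x∉p⇒x∈∁p y∉A′))
    matched : ∀ v → Adj v (partner v) × partner (partner v) ≡ v
    matched v with v ∈? A
    ... | yes v∈A = g-adjacent v∈A , g-injective (proj₁ back) v∈A (proj₂ back)
      where
      back : partner (g v) ∈ A × g (partner (g v)) ≡ g v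
      back = partner-out (independent (g-adjacent v∈A) v∈A)
    ... | no  v∉A = Adj-sym (subst (Adj _) ga≡v (g-adjacent a∈A)) , trans (partner-in a∈A) ga≡v
      where
      a∈A : proj₁ (onto (x∉p⇒x∈∁p v∉A)) ∈ A
      a∈A = proj₁ (proj₂ (onto (x∉p⇒x∈∁p v∉A)))
      ga≡v : g (proj₁ (onto (x∉p⇒x∈∁p v∉A))) ≡ v
      ga≡v = proj₂ (proj₂ (onto (x∉p⇒x∈∁p v∉A)))

module MinimumCovers (G : Graph) {k : ℕ} (minimal : ∀ S → VertexCover G S → k ≤ ∣ S ∣) where
  open Graph G using (Adj; adj?) renaming (n to V)

  private
    variable
      A C D : Subset V

  MinimumCover : Subset V → Set
  MinimumCover D = VertexCover G D × ∣ D ∣ ≤ k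

  select-minimum : ColourClass G A → MinimumCover C → MinimumCover D →
                   MinimumCover (select A (C ∪ D) (C ∩ D))
  select-minimum {A} {C} {D} classA (coverC , ∣C∣≤k) (coverD , ∣D∣≤k) =
    select-cover G classA coverC coverD , +-cancelʳ-≤ k ∣ E ∣ k (begin
      ∣ E ∣ + k              ≤⟨ +-monoʳ-≤ ∣ E ∣ (minimal F F-cover) ⟩
      ∣ E ∣ + ∣ F ∣          ≡⟨ ∣select∣+∣select-∁∣≡∣p∣+∣q∣ A (C ∪ D) (C ∩ D) ⟩
      ∣ C ∪ D ∣ + ∣ C ∩ D ∣  ≡⟨ ∣p∪q∣+∣p∩q∣≡∣p∣+∣q∣ C D ⟩
      ∣ C ∣ + ∣ D ∣          ≤⟨ +-mono-≤ ∣C∣≤k ∣D∣≤k ⟩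
      k + k                  ∎)
    where
    open ≤-Reasoning
    E F : Subset V
    E = select A (C ∪ D) (C ∩ D)
    F = select (∁ A) (C ∪ D) (C ∩ D)
    F-cover : VertexCover G F
    F-cover = select-cover G (colourClass-∁ G classA) coverC coverD

  colourClass⇒minimumCover : ColourClass G A → (∀ x → ∃ λ D → x ∈ D × MinimumCover D) → MinimumCover C →
                             MinimumCover A
  colourClass⇒minimumCover {A} {C} classA inMinimum minC =
    proj₁ classA , ≤-trans (p⊆q⇒∣p∣≤∣q∣ (λ {x} x∈A → All.lookup covered (∈-allFin x) x∈A)) ∣D⁺∣≤k
    where
    extend : ∀ xs → ∃ λ D → MinimumCover D × All (λ x → x ∈ A → x ∈ D) xs
    extend []       = C , minC , []
    extend (x ∷ xs) with extend xs | inMinimum x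
    ... | D , minD , covered | Dₓ , x∈Dₓ , minDₓ =
      select A (D ∪ Dₓ) (D ∩ Dₓ) , select-minimum classA minD minDₓ ,
      (λ x∈A → x∈a⇒x∈p⇒x∈select x∈A (x∈p∪q⁺ (inj₂ x∈Dₓ))) ∷
      All.map (λ y∈D y∈A → x∈a⇒x∈p⇒x∈select y∈A (x∈p∪q⁺ (inj₁ (y∈D y∈A)))) covered
    D⁺ : Subset V
    D⁺ = proj₁ (extend (allFin V))
    covered : All (λ x → x ∈ A → x ∈ D⁺) (allFin V)
    covered = proj₂ (proj₂ (extend (allFin V)))
    ∣D⁺∣≤k : ∣ D⁺ ∣ ≤ k
    ∣D⁺∣≤k = proj₂ (proj₁ (proj₂ (extend (allFin V))))

  minimumCover⇒hall : MinimumCover A → HallCondition (neighbours G) A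
  minimumCover⇒hall {A} (coverA , ∣A∣≤k) {S} S⊆A = +-cancelˡ-≤ ∣ A ─ S ∣ _ _ (begin
    ∣ A ─ S ∣ + ∣ S ∣         ≡⟨ q⊆p⇒∣p─q∣+∣q∣≡∣p∣ S⊆A ⟩
    ∣ A ∣                     ≤⟨ ∣A∣≤k ⟩
    k                         ≤⟨ minimal _ (cover-via G coverA from-A) ⟩
    ∣ (A ─ S) ∪ N[S] ∣        ≤⟨ ∣p∪q∣≤∣p∣+∣q∣ (A ─ S) N[S] ⟩
    ∣ A ─ S ∣ + ∣ N[S] ∣      ∎)
    where
    open ≤-Reasoning
    N[S] : Subset V
    N[S] = N (neighbours G) S
    from-A : ∀ {u v} → Adj u v → u ∈ A → u ∈ (A ─ S) ∪ N[S] ⊎ v ∈ (A ─ S) ∪ N[S]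
    from-A {u} u~v u∈A with u ∈? S
    ... | yes u∈S = inj₂ (x∈p∪q⁺ (inj₂ (∈N⁺ u∈S (∈-fromDec⁺ (adj? u) u~v))))
    ... | no  u∉S = inj₁ (x∈p∪q⁺ (inj₁ (x∈p∧x∉q⇒x∈p─q u∈A u∉S)))

proposition4 : (G : Graph) → 2 ≤ Graph.n G → Connected G → Bipartite G → Spartan G
    → PerfectMatching G
proposition4 G 2≤n connected (c , proper) (k , (_ , minimal) , (win , _)) =
  transversal⇒perfectMatching G classA (proj₂ (hall (minimumCover⇒hall minA)))
    (≤-trans (proj₂ min∁A) (minimal A (proj₁ classA)))
  where
  open MinimumCovers G minimal
  A : Subset (Graph.n G)
  A = fromDec (T? ∘ c)
  classA : ColourClass G A
  classA = colouring⇒colourClass G c proper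
  inMinimumCover : ∀ x → ∃ λ D → x ∈ D × MinimumCover D
  inMinimumCover x = winning⇒vertex∈smallCover G win (proj₂ (connected⇒neighbour G 2≤n connected x))
  initial : MinimumCover (proj₁ win [])
  initial = winning⇒VertexCover G win [] [] , ≤-reflexive (proj₁ (proj₂ win))
  minA : MinimumCover A
  minA = colourClass⇒minimumCover classA inMinimumCover initial
  min∁A : MinimumCover (∁ A)
  min∁A = colourClass⇒minimumCover (colourClass-∁ G classA) inMinimumCover initial
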